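{- Let $\mathcal{C}$ be a cd-category. The relation "$g$ normalises $f$" between morphisms $X\to Y$ is (1) transitive: if $g$ normalises $f$ and $h$ normalises $g$ then $h$ normalises $f$; and (2) antisymmetric: if $f$ and $g$ normalise each other then $f=g$.
   Context: A cd-category is a symmetric monoidal category $(\mathcal{C},\otimes,I)$ in which every object $X$ carries $\Delta_X\colon X\to X\otimes X$ and $\epsilon_X\colon X\to I$ forming a commutative comonoid, compatible with the tensor ($\Delta_{X\otimes Y}=(\mathrm{id}\otimes\sigma\otimes\mathrm{id})\circ(\Delta_X\otimes\Delta_Y)$, $\epsilon_{X\otimes Y}=\epsilon_X\otimes\epsilon_Y$, $\Delta_I=\epsilon_I=\mathrm{id}_I$). For $f,g\colon X\to Y$, $g$ normalises $f$ if $f=(g\otimes(\epsilon_Y\circ f))\circ\Delta_X$ (identifying $Y\otimes I\cong Y$). -}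

module Defs where

open import Level using (Level; suc; _⊔_)
open import Relation.Binary using (Rel; IsEquivalence)

record CDCategory (o ℓ e : Level) : Set (suc (o ⊔ ℓ ⊔ e)) where
  infixr 9 _∘_
  infixr 10 _⊗₁_
  infixr 10 _⊗₀_
  infix  4 _≈_
  field
    Obj   : Set o
    _⇒_   : Obj → Obj → Set ℓ
    _≈_   : ∀ {A B} → Rel (A ⇒ B) e
    id    : ∀ {A} → A ⇒ A
    _∘_   : ∀ {A B C} → B ⇒ C → A ⇒ B → A ⇒ C
    ≈-equiv : ∀ {A B} → IsEquivalence (_≈_ {A} {B})
    ∘-resp-≈ : ∀ {A B C} {f h : B ⇒ C} {g i : A ⇒ B} → f ≈ h → g ≈ i → f ∘ g ≈ h ∘ i
    assoc : ∀ {A B C D} {f : A ⇒ B} {g : B ⇒ C} {h : C ⇒ D} → (h ∘ g) ∘ f ≈ h ∘ (g ∘ f)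
    identityˡ : ∀ {A B} {f : A ⇒ B} → id ∘ f ≈ f
    identityʳ : ∀ {A B} {f : A ⇒ B} → f ∘ id ≈ f

    _⊗₀_ : Obj → Obj → Obj
    _⊗₁_ : ∀ {A B C D} → A ⇒ B → C ⇒ D → (A ⊗₀ C) ⇒ (B ⊗₀ D)
    I    : Obj
    ⊗-identity : ∀ {A B} → id {A} ⊗₁ id {B} ≈ id
    ⊗-homomorphism : ∀ {A B C D E F} {f : A ⇒ B} {g : B ⇒ C} {h : D ⇒ E} {k : E ⇒ F}
                   → (g ∘ f) ⊗₁ (k ∘ h) ≈ (g ⊗₁ k) ∘ (f ⊗₁ h)
    ⊗-resp-≈ : ∀ {A B C D} {f g : A ⇒ B} {h k : C ⇒ D} → f ≈ g → h ≈ k → f ⊗₁ h ≈ g ⊗₁ k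

    α⇒ : ∀ {X Y Z} → ((X ⊗₀ Y) ⊗₀ Z) ⇒ (X ⊗₀ (Y ⊗₀ Z))
    α⇐ : ∀ {X Y Z} → (X ⊗₀ (Y ⊗₀ Z)) ⇒ ((X ⊗₀ Y) ⊗₀ Z)
    α-isoˡ : ∀ {X Y Z} → α⇐ {X} {Y} {Z} ∘ α⇒ ≈ id
    α-isoʳ : ∀ {X Y Z} → α⇒ {X} {Y} {Z} ∘ α⇐ ≈ id
    α-natural : ∀ {X X' Y Y' Z Z'} {f : X ⇒ X'} {g : Y ⇒ Y'} {h : Z ⇒ Z'}
              → α⇒ ∘ ((f ⊗₁ g) ⊗₁ h) ≈ (f ⊗₁ (g ⊗₁ h)) ∘ α⇒

    λ⇒ : ∀ {X} → (I ⊗₀ X) ⇒ X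
    λ⇐ : ∀ {X} → X ⇒ (I ⊗₀ X)
    λ-isoˡ : ∀ {X} → λ⇐ {X} ∘ λ⇒ ≈ id
    λ-isoʳ : ∀ {X} → λ⇒ {X} ∘ λ⇐ ≈ id
    λ-natural : ∀ {X Y} {f : X ⇒ Y} → λ⇒ ∘ (id ⊗₁ f) ≈ f ∘ λ⇒

    ρ⇒ : ∀ {X} → (X ⊗₀ I) ⇒ X
    ρ⇐ : ∀ {X} → X ⇒ (X ⊗₀ I)
    ρ-isoˡ : ∀ {X} → ρ⇐ {X} ∘ ρ⇒ ≈ id
    ρ-isoʳ : ∀ {X} → ρ⇒ {X} ∘ ρ⇐ ≈ id
    ρ-natural : ∀ {X Y} {f : X ⇒ Y} → ρ⇒ ∘ (f ⊗₁ id) ≈ f ∘ ρ⇒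

    pentagon : ∀ {W X Y Z}
             → α⇒ {W} {X} {Y ⊗₀ Z} ∘ α⇒ {W ⊗₀ X} {Y} {Z}
               ≈ (id ⊗₁ α⇒) ∘ (α⇒ ∘ (α⇒ ⊗₁ id))
    triangle : ∀ {X Y} → (id {X} ⊗₁ λ⇒ {Y}) ∘ α⇒ ≈ ρ⇒ ⊗₁ id

    σ : ∀ {X Y} → (X ⊗₀ Y) ⇒ (Y ⊗₀ X)
    σ-natural : ∀ {X X' Y Y'} {f : X ⇒ X'} {g : Y ⇒ Y'} → σ ∘ (f ⊗₁ g) ≈ (g ⊗₁ f) ∘ σ
    σ-involutive : ∀ {X Y} → σ {Y} {X} ∘ σ {X} {Y} ≈ id
    hexagon : ∀ {X Y Z}
            → α⇒ {Y} {Z} {X} ∘ (σ {X} {Y ⊗₀ Z} ∘ α⇒)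
              ≈ (id ⊗₁ σ) ∘ (α⇒ ∘ (σ ⊗₁ id))

    Δ : ∀ {X} → X ⇒ (X ⊗₀ X)
    ε : ∀ {X} → X ⇒ I
    Δ-coassoc : ∀ {X} → α⇒ ∘ ((Δ ⊗₁ id) ∘ Δ {X}) ≈ (id ⊗₁ Δ) ∘ Δ
    Δ-counitˡ : ∀ {X} → λ⇒ ∘ ((ε ⊗₁ id) ∘ Δ {X}) ≈ id
    Δ-counitʳ : ∀ {X} → ρ⇒ ∘ ((id ⊗₁ ε) ∘ Δ {X}) ≈ id
    Δ-comm : ∀ {X} → σ ∘ Δ {X} ≈ Δ
    -- compatibility with the tensor:
    -- Δ_{X⊗Y} = (id ⊗ σ ⊗ id) ∘ (Δ_X ⊗ Δ_Y)   (associators inserted)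
    Δ-⊗ : ∀ {X Y} → Δ {X ⊗₀ Y}
          ≈ (α⇐ ∘ ((id ⊗₁ (α⇒ ∘ ((σ ⊗₁ id) ∘ α⇐))) ∘ α⇒)) ∘ (Δ {X} ⊗₁ Δ {Y})
    ε-⊗ : ∀ {X Y} → ε {X ⊗₀ Y} ≈ λ⇒ ∘ (ε {X} ⊗₁ ε {Y})
    Δ-I : Δ {I} ≈ λ⇐
    ε-I : ε {I} ≈ id

  Normalises : ∀ {X Y} → X ⇒ Y → X ⇒ Y → Set e
  Normalises {X} {Y} g f = f ≈ ρ⇒ ∘ ((g ⊗₁ (ε {Y} ∘ f)) ∘ Δ {X})

{-# OPTIONS --safe #-}
-- Write k ▸ a = ρ ∘ (k ⊗ a) ∘ Δ for k : X → Y and a "scalar" a : X → I, so that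
-- g normalises f exactly when f = g ▸ (ε ∘ f).  This action is associative,
-- (k ▸ a) ▸ b = k ▸ (a ▸ b) by coassociativity of Δ, it commutes with discarding,
-- ε ∘ (k ▸ a) = (ε ∘ k) ▸ a, and on scalars it is commutative by cocommutativity.
-- Transitivity is then a rewriting of f = g ▸ εf = (h ▸ εg) ▸ εf = h ▸ (εg ▸ εf) = h ▸ εf.
-- For antisymmetry, commutativity gives εf = εg ▸ εf = εf ▸ εg = εg, and transitivity
-- shows that g normalises itself, so f = g ▸ εf = g ▸ εg = g.
module Submission where

open import Defs
open import Level using (Level)
open import Data.Product using (_×_; _,_)
open import Relation.Binary using (Setoid)
import Relation.Binary.Reasoning.Setoid as SetoidReasoning

module NormalisationOrder {o ℓ e : Level} (C : CDCategory o ℓ e) where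
  open CDCategory C

  hom-setoid : Obj → Obj → Setoid ℓ e
  hom-setoid A B = record { Carrier = A ⇒ B ; _≈_ = _≈_ ; isEquivalence = ≈-equiv }

  module HomReasoning {A B : Obj} = SetoidReasoning (hom-setoid A B)

  module _ {A B : Obj} where
    open Setoid (hom-setoid A B) public using () renaming (refl to ≈-refl; sym to ≈-sym; trans to ≈-trans)

  ∘-resp-≈ʳ : ∀ {A B C} {f : B ⇒ C} {g h : A ⇒ B} → g ≈ h → f ∘ g ≈ f ∘ h
  ∘-resp-≈ʳ p = ∘-resp-≈ ≈-refl p

  ∘-resp-≈ˡ : ∀ {A B C} {f h : B ⇒ C} {g : A ⇒ B} → f ≈ h → f ∘ g ≈ h ∘ g
  ∘-resp-≈ˡ p = ∘-resp-≈ p ≈-refl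

  split-id : ∀ {A B} {f : A ⇒ B} → f ≈ id ∘ (f ∘ id)
  split-id = ≈-sym (≈-trans identityˡ identityʳ)

  ∘-cancel-iso : ∀ {A B C} {f g : A ⇒ C} {u : B ⇒ A} {v : A ⇒ B}
               → u ∘ v ≈ id → f ∘ u ≈ g ∘ u → f ≈ g
  ∘-cancel-iso {f = f} {g} {u} {v} uv p = begin
      f             ≈⟨ ≈-sym identityʳ ⟩
      f ∘ id        ≈⟨ ∘-resp-≈ʳ uv ⟨
      f ∘ (u ∘ v)   ≈⟨ assoc ⟨
      (f ∘ u) ∘ v   ≈⟨ ∘-resp-≈ˡ p ⟩
      (g ∘ u) ∘ v   ≈⟨ assoc ⟩
      g ∘ (u ∘ v)   ≈⟨ ∘-resp-≈ʳ uv ⟩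
      g ∘ id        ≈⟨ identityʳ ⟩
      g             ∎
    where open HomReasoning

  ρ∘λ⁻¹-on-I : ρ⇒ {I} ∘ λ⇐ ≈ id
  ρ∘λ⁻¹-on-I = begin
      ρ⇒ ∘ λ⇐                ≈⟨ ∘-resp-≈ʳ identityˡ ⟨
      ρ⇒ ∘ (id ∘ λ⇐)         ≈⟨ ∘-resp-≈ʳ (∘-resp-≈ (≈-trans (⊗-resp-≈ ≈-refl ε-I) ⊗-identity) Δ-I) ⟨
      ρ⇒ ∘ ((id ⊗₁ ε) ∘ Δ)   ≈⟨ Δ-counitʳ ⟩
      id                     ∎
    where open HomReasoning

  ρ≈λ-on-I : ρ⇒ {I} ≈ λ⇒ {I}
  ρ≈λ-on-I = ∘-cancel-iso λ-isoˡ (≈-trans ρ∘λ⁻¹-on-I (≈-sym λ-isoʳ))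

  σ-on-I : σ {I} {I} ≈ id
  σ-on-I = ∘-cancel-iso λ-isoˡ (begin
      σ ∘ λ⇐    ≈⟨ ∘-resp-≈ʳ Δ-I ⟨
      σ ∘ Δ     ≈⟨ Δ-comm ⟩
      Δ         ≈⟨ Δ-I ⟩
      λ⇐        ≈⟨ identityˡ ⟨
      id ∘ λ⇐   ∎)
    where open HomReasoning

  infixl 8 _▸_
  _▸_ : ∀ {X Y} → X ⇒ Y → X ⇒ I → X ⇒ Y
  k ▸ a = ρ⇒ ∘ ((k ⊗₁ a) ∘ Δ)

  ▸-resp-≈ : ∀ {X Y} {k k′ : X ⇒ Y} {a a′ : X ⇒ I} → k ≈ k′ → a ≈ a′ → k ▸ a ≈ k′ ▸ a′
  ▸-resp-≈ p q = ∘-resp-≈ʳ (∘-resp-≈ˡ (⊗-resp-≈ p q))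

  ε-▸ : ∀ {X Y} (k : X ⇒ Y) (a : X ⇒ I) → ε ∘ (k ▸ a) ≈ (ε ∘ k) ▸ a
  ε-▸ k a = begin
      ε ∘ (ρ⇒ ∘ ((k ⊗₁ a) ∘ Δ))                ≈⟨ assoc ⟨
      (ε ∘ ρ⇒) ∘ ((k ⊗₁ a) ∘ Δ)                ≈⟨ ∘-resp-≈ˡ ρ-natural ⟨
      (ρ⇒ ∘ (ε ⊗₁ id)) ∘ ((k ⊗₁ a) ∘ Δ)        ≈⟨ assoc ⟩
      ρ⇒ ∘ ((ε ⊗₁ id) ∘ ((k ⊗₁ a) ∘ Δ))        ≈⟨ ∘-resp-≈ʳ assoc ⟨
      ρ⇒ ∘ (((ε ⊗₁ id) ∘ (k ⊗₁ a)) ∘ Δ)        ≈⟨ ∘-resp-≈ʳ (∘-resp-≈ˡ ⊗-homomorphism) ⟨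
      ρ⇒ ∘ (((ε ∘ k) ⊗₁ (id ∘ a)) ∘ Δ)         ≈⟨ ▸-resp-≈ ≈-refl identityˡ ⟩
      ρ⇒ ∘ (((ε ∘ k) ⊗₁ a) ∘ Δ)                ∎
    where open HomReasoning

  ρ∘ρ⊗id≈ρ∘id⊗ρ∘α : ∀ {X} → ρ⇒ ∘ (ρ⇒ {X} ⊗₁ id {I}) ≈ (ρ⇒ ∘ (id ⊗₁ ρ⇒)) ∘ α⇒
  ρ∘ρ⊗id≈ρ∘id⊗ρ∘α = begin
      ρ⇒ ∘ (ρ⇒ ⊗₁ id)              ≈⟨ ∘-resp-≈ʳ triangle ⟨
      ρ⇒ ∘ ((id ⊗₁ λ⇒) ∘ α⇒)       ≈⟨ ∘-resp-≈ʳ (∘-resp-≈ˡ (⊗-resp-≈ ≈-refl ρ≈λ-on-I)) ⟨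
      ρ⇒ ∘ ((id ⊗₁ ρ⇒) ∘ α⇒)       ≈⟨ assoc ⟨
      (ρ⇒ ∘ (id ⊗₁ ρ⇒)) ∘ α⇒       ∎
    where open HomReasoning

  ▸-assoc : ∀ {X Y} (k : X ⇒ Y) (a b : X ⇒ I) → k ▸ a ▸ b ≈ k ▸ (a ▸ b)
  ▸-assoc {X} {Y} k a b = ≈-trans left (≈-sym right)
    where
      open HomReasoning
      copy³ : X ⇒ ((Y ⊗₀ I) ⊗₀ I)
      copy³ = ((k ⊗₁ a) ⊗₁ b) ∘ ((Δ ⊗₁ id) ∘ Δ)

      left : k ▸ a ▸ b ≈ ((ρ⇒ ∘ (id ⊗₁ ρ⇒)) ∘ α⇒) ∘ copy³
      left = begin
        ρ⇒ ∘ (((ρ⇒ ∘ ((k ⊗₁ a) ∘ Δ)) ⊗₁ b) ∘ Δ)                  ≈⟨ ▸-resp-≈ ≈-refl split-id ⟩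
        ρ⇒ ∘ (((ρ⇒ ∘ ((k ⊗₁ a) ∘ Δ)) ⊗₁ (id ∘ (b ∘ id))) ∘ Δ)
          ≈⟨ ∘-resp-≈ʳ (∘-resp-≈ˡ (≈-trans ⊗-homomorphism (∘-resp-≈ʳ ⊗-homomorphism))) ⟩
        ρ⇒ ∘ (((ρ⇒ ⊗₁ id) ∘ (((k ⊗₁ a) ⊗₁ b) ∘ (Δ ⊗₁ id))) ∘ Δ)  ≈⟨ ∘-resp-≈ʳ (≈-trans assoc (∘-resp-≈ʳ assoc)) ⟩
        ρ⇒ ∘ ((ρ⇒ ⊗₁ id) ∘ copy³)                                ≈⟨ assoc ⟨
        (ρ⇒ ∘ (ρ⇒ ⊗₁ id)) ∘ copy³                                ≈⟨ ∘-resp-≈ˡ ρ∘ρ⊗id≈ρ∘id⊗ρ∘α ⟩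
        ((ρ⇒ ∘ (id ⊗₁ ρ⇒)) ∘ α⇒) ∘ copy³                         ∎

      right : k ▸ (a ▸ b) ≈ ((ρ⇒ ∘ (id ⊗₁ ρ⇒)) ∘ α⇒) ∘ copy³
      right = begin
        ρ⇒ ∘ ((k ⊗₁ (ρ⇒ ∘ ((a ⊗₁ b) ∘ Δ))) ∘ Δ)                  ≈⟨ ▸-resp-≈ split-id ≈-refl ⟩
        ρ⇒ ∘ (((id ∘ (k ∘ id)) ⊗₁ (ρ⇒ ∘ ((a ⊗₁ b) ∘ Δ))) ∘ Δ)
          ≈⟨ ∘-resp-≈ʳ (∘-resp-≈ˡ (≈-trans ⊗-homomorphism (∘-resp-≈ʳ ⊗-homomorphism))) ⟩
        ρ⇒ ∘ (((id ⊗₁ ρ⇒) ∘ ((k ⊗₁ (a ⊗₁ b)) ∘ (id ⊗₁ Δ))) ∘ Δ)  ≈⟨ ∘-resp-≈ʳ (≈-trans assoc (∘-resp-≈ʳ assoc)) ⟩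
        ρ⇒ ∘ ((id ⊗₁ ρ⇒) ∘ ((k ⊗₁ (a ⊗₁ b)) ∘ ((id ⊗₁ Δ) ∘ Δ)))  ≈⟨ ∘-resp-≈ʳ (∘-resp-≈ʳ (∘-resp-≈ʳ Δ-coassoc)) ⟨
        ρ⇒ ∘ ((id ⊗₁ ρ⇒) ∘ ((k ⊗₁ (a ⊗₁ b)) ∘ (α⇒ ∘ ((Δ ⊗₁ id) ∘ Δ))))
          ≈⟨ ∘-resp-≈ʳ (∘-resp-≈ʳ (≈-trans (≈-sym assoc) (∘-resp-≈ˡ (≈-sym α-natural)))) ⟩
        ρ⇒ ∘ ((id ⊗₁ ρ⇒) ∘ ((α⇒ ∘ ((k ⊗₁ a) ⊗₁ b)) ∘ ((Δ ⊗₁ id) ∘ Δ)))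
          ≈⟨ ∘-resp-≈ʳ (∘-resp-≈ʳ assoc) ⟩
        ρ⇒ ∘ ((id ⊗₁ ρ⇒) ∘ (α⇒ ∘ copy³))                          ≈⟨ ≈-trans (≈-sym assoc) (≈-sym assoc) ⟩
        ((ρ⇒ ∘ (id ⊗₁ ρ⇒)) ∘ α⇒) ∘ copy³                          ∎

  ▸-comm-scalar : ∀ {X} (a b : X ⇒ I) → a ▸ b ≈ b ▸ a
  ▸-comm-scalar a b = begin
      ρ⇒ ∘ ((a ⊗₁ b) ∘ Δ)          ≈⟨ ∘-resp-≈ʳ (∘-resp-≈ʳ Δ-comm) ⟨
      ρ⇒ ∘ ((a ⊗₁ b) ∘ (σ ∘ Δ))    ≈⟨ ∘-resp-≈ʳ assoc ⟨
      ρ⇒ ∘ (((a ⊗₁ b) ∘ σ) ∘ Δ)    ≈⟨ ∘-resp-≈ʳ (∘-resp-≈ˡ σ-natural) ⟨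
      ρ⇒ ∘ ((σ ∘ (b ⊗₁ a)) ∘ Δ)    ≈⟨ ∘-resp-≈ʳ (≈-trans assoc (∘-resp-≈ˡ σ-on-I)) ⟩
      ρ⇒ ∘ (id ∘ ((b ⊗₁ a) ∘ Δ))   ≈⟨ ∘-resp-≈ʳ identityˡ ⟩
      ρ⇒ ∘ ((b ⊗₁ a) ∘ Δ)          ∎
    where open HomReasoning

  ε-normalised : ∀ {X Y} {f g : X ⇒ Y} → Normalises g f → ε ∘ f ≈ (ε ∘ g) ▸ (ε ∘ f)
  ε-normalised {f = f} {g} g⊳f = ≈-trans (∘-resp-≈ʳ g⊳f) (ε-▸ g (ε ∘ f))

  normalises-trans : ∀ {X Y} {f g h : X ⇒ Y} → Normalises g f → Normalises h g → Normalises h f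
  normalises-trans {f = f} {g} {h} g⊳f h⊳g = begin
      f                       ≈⟨ g⊳f ⟩
      g ▸ ε ∘ f               ≈⟨ ▸-resp-≈ h⊳g ≈-refl ⟩
      h ▸ ε ∘ g ▸ ε ∘ f       ≈⟨ ▸-assoc h (ε ∘ g) (ε ∘ f) ⟩
      h ▸ ((ε ∘ g) ▸ ε ∘ f)   ≈⟨ ▸-resp-≈ ≈-refl (ε-normalised g⊳f) ⟨
      h ▸ ε ∘ f               ∎
    where open HomReasoning

  normalises-antisym : ∀ {X Y} {f g : X ⇒ Y} → Normalises g f → Normalises f g → f ≈ g
  normalises-antisym {f = f} {g} g⊳f f⊳g = begin
      f           ≈⟨ g⊳f ⟩
      g ▸ ε ∘ f   ≈⟨ ▸-resp-≈ ≈-refl same-discard ⟩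
      g ▸ ε ∘ g   ≈⟨ normalises-trans f⊳g g⊳f ⟨
      g           ∎
    where
      open HomReasoning
      same-discard : ε ∘ f ≈ ε ∘ g
      same-discard = begin
        ε ∘ f                   ≈⟨ ε-normalised g⊳f ⟩
        (ε ∘ g) ▸ (ε ∘ f)       ≈⟨ ▸-comm-scalar (ε ∘ g) (ε ∘ f) ⟩
        (ε ∘ f) ▸ (ε ∘ g)       ≈⟨ ε-normalised f⊳g ⟨
        ε ∘ g                   ∎

lemmaB2 : ∀ {o ℓ e : Level} (C : CDCategory o ℓ e) → let open CDCategory C in
    (∀ {X Y} {f g h : X ⇒ Y} → Normalises g f → Normalises h g → Normalises h f)
    × (∀ {X Y} {f g : X ⇒ Y} → Normalises g f → Normalises f g → f ≈ g)
lemmaB2 C = normalises-trans , normalises-antisym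
  where open NormalisationOrder C
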